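{- Let $A\in\mathbb{F}_2^{(m+1)\times(m+1)}$ be a pseudo-quadratic matrix of rank $k$ over $\mathbb{F}_2$. Then there exist an odd integer $k_0<3k/2+1$ and vectors $v_1,\dots,v_{k_0}\in\mathbb{F}_2^{m+1}$ such that $v_{i,1}=1$ for all $i\in[k_0]$ and $A=\sum_{i=1}^{k_0}v_i\otimes v_i$. Moreover, for all $i\in[k_0]$, $D_1(v_i)$ lies in the column space of $D_1(A)$.
   Context: A matrix $A\in\mathbb{F}_2^{(m+1)\times(m+1)}$ is pseudo-quadratic if $A$ is symmetric, $A_{1,1}=1$, and $A_{1,i}=A_{i,1}=A_{i,i}$ for all $i=2,\dots,m+1$. $D_1:\mathbb{F}_2^{m+1}\to\mathbb{F}_2^m$ removes the first coordinate of a vector; for matrices, $D_1$ removes the first row and first column. For vectors $u,w$, $u\otimes w$ is the matrix with entries $u_iw_j$. -}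

module Defs where

open import Data.Bool using (Bool; true; false; _xor_; _∧_)
open import Data.Nat using (ℕ; zero; suc; _+_; _*_)
open import Data.Fin using (Fin; zero; suc)
open import Data.Product using (Σ; ∃; _×_)
open import Relation.Binary.PropositionalEquality using (_≡_)

-- The field F₂ is modelled by Bool: addition = xor, multiplication = ∧.
F₂ : Set
F₂ = Bool

-- Vectors in F₂ⁿ and n×n matrices (as functions). Index `zero` is the
-- paper's first coordinate.
Vec₂ : ℕ → Set
Vec₂ n = Fin n → F₂

Mat₂ : ℕ → Set
Mat₂ n = Fin n → Fin n → F₂

sum₂ : (k : ℕ) → (Fin k → F₂) → F₂
sum₂ zero    f = false
sum₂ (suc k) f = f zero xor sum₂ k (λ i → f (suc i))

lincomb : ∀ {n} (k : ℕ) → (Fin k → F₂) → (Fin k → Vec₂ n) → Vec₂ n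
lincomb k c b x = sum₂ k (λ j → c j ∧ b j x)

_≐_ : ∀ {n} → Vec₂ n → Vec₂ n → Set
u ≐ w = ∀ x → u x ≡ w x

InColSpace : ∀ {n} → Mat₂ n → Vec₂ n → Set
InColSpace {n} M y = Σ (Vec₂ n) λ c → y ≐ (λ x → sum₂ n (λ j → M x j ∧ c j))

InSpan : ∀ {n} (k : ℕ) → (Fin k → Vec₂ n) → Vec₂ n → Set
InSpan k b y = Σ (Fin k → F₂) λ c → y ≐ lincomb k c b

LinIndep : ∀ {n} (k : ℕ) → (Fin k → Vec₂ n) → Set
LinIndep {n} k b = (c : Fin k → F₂) → lincomb k c b ≐ (λ _ → false) → ∀ j → c j ≡ false

HasRank : ∀ {n} → Mat₂ n → ℕ → Set
HasRank {n} M k = Σ (Fin k → Vec₂ n) λ b →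
  LinIndep k b
  × (∀ j → InColSpace M (b j))
  × (∀ y → InColSpace M y → InSpan k b y)

PseudoQuadratic : ∀ {m} → Mat₂ (suc m) → Set
PseudoQuadratic {m} A =
  (∀ i j → A i j ≡ A j i)
  × A zero zero ≡ true
  × (∀ (i : Fin m) → A zero (suc i) ≡ A (suc i) (suc i))
  × (∀ (i : Fin m) → A (suc i) zero ≡ A (suc i) (suc i))

D₁ : ∀ {m} → Vec₂ (suc m) → Vec₂ m
D₁ v i = v (suc i)

D₁ᴹ : ∀ {m} → Mat₂ (suc m) → Mat₂ m
D₁ᴹ A i j = A (suc i) (suc j)

Odd : ℕ → Set
Odd n = ∃ λ j → n ≡ 2 * j + 1

module Submission where

-- Write A = U S Uᵀ, where S = (bₗ·gⱼ) is the k×k Gram matrix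
-- of a basis bⱼ = A gⱼ of the column space and row U x holds the coordinates
-- of column x of A in that basis.  Over F₂ the diagonal of a symmetric matrix
-- lies in its column space; combined with injectivity of d ↦ U S d this turns
-- the pseudo-quadratic conditions on A into: diag S = S μ and μᵀ S μ = 1, for
-- μ = U₁ the coordinates of the first column.  For such S, with s = S μ, the matrix S + s sᵀ is alternating
-- and has μ in its kernel, so symplectic Gram–Schmidt writes it as at most
-- (k-1)/2 hyperbolic pairs a bᵀ + b aᵀ = (a+b)(a+b)ᵀ + a aᵀ + b bᵀ, i.e.
-- as a sum of squares y yᵀ; pad to an odd number of terms and shift every
-- y to s + y: since Σ y = diag(S + s sᵀ) = 0 the shifted squares sum to S.
-- Pushing the vectors z = s + y forward along U gives the vᵢ = U z.

open import Defs
open import Data.Bool using (true; false; not; _xor_; _∧_)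
open import Data.Bool.Properties
  using (_≟_; ∧-comm; ∧-idem; ∧-zeroʳ; ∧-identityʳ; ∧-conicalˡ; ∧-distribˡ-xor; ∧-distribʳ-xor;
         xor-same; xor-identityʳ; ¬-not)
open import Data.Bool.Solver using (module xor-∧-Solver)
open import Data.Nat using (ℕ; zero; suc; _+_; _*_; _<_; _≤_; z≤n; s≤s)
open import Data.Nat.Properties
  using (≤-refl; ≤-trans; ≤-reflexive; ≤-pred; <-≤-trans; n≤1+n; n≮0; +-suc; +-comm; *-suc; *-monoʳ-≤; m≤m+n)
open import Data.Nat.Tactic.RingSolver using (solve-∀)
open import Data.Fin using (Fin; zero; suc)
open import Data.Fin.Properties using (any?; suc-injective) renaming (_≟_ to _≟ᶠ_)
open import Data.List using (List; []; _∷_; length; lookup; map)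
open import Data.List.Properties using (length-map)
open import Data.List.Membership.Propositional.Properties using (∈-lookup)
open import Data.List.Relation.Unary.All using (All; []; _∷_)
import Data.List.Relation.Unary.All as All
open import Data.List.Relation.Unary.All.Properties using (map⁺)
open import Data.Product using (Σ; ∃; _×_; _,_; proj₁; proj₂)
open import Data.Empty using (⊥-elim)
open import Function using (_∘_; id)
open import Relation.Nullary using (yes; no; ¬?; _×-dec_)
open import Relation.Binary.PropositionalEquality
  using (_≡_; _≢_; refl; sym; trans; cong; cong₂; subst)
open Relation.Binary.PropositionalEquality.≡-Reasoning

-- The solver normalises
-- polynomials with coefficients computed in F₂ itself, so it also proves
-- characteristic-two identities such as x + x = 0 (but not x x = x).
open xor-∧-Solver using (solve; _:+_; _:*_; _:=_; con)

sum-cong : ∀ n {f g : Fin n → F₂} → (∀ i → f i ≡ g i) → sum₂ n f ≡ sum₂ n g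
sum-cong zero    f≗g = refl
sum-cong (suc n) f≗g = cong₂ _xor_ (f≗g zero) (sum-cong n (f≗g ∘ suc))

sum-zero : ∀ n → sum₂ n (λ _ → false) ≡ false
sum-zero zero    = refl
sum-zero (suc n) = sum-zero n

sum-xor : ∀ n (f g : Fin n → F₂) →
          sum₂ n (λ i → f i xor g i) ≡ sum₂ n f xor sum₂ n g
sum-xor zero    f g = refl
sum-xor (suc n) f g = begin
  (f zero xor g zero) xor sum₂ n (λ i → f (suc i) xor g (suc i))
    ≡⟨ cong ((f zero xor g zero) xor_) (sum-xor n (f ∘ suc) (g ∘ suc)) ⟩
  (f zero xor g zero) xor (sum₂ n (f ∘ suc) xor sum₂ n (g ∘ suc))
    ≡⟨ interchange (f zero) (g zero) _ _ ⟩
  (f zero xor sum₂ n (f ∘ suc)) xor (g zero xor sum₂ n (g ∘ suc)) ∎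
  where
  interchange : ∀ a b c d → (a xor b) xor (c xor d) ≡ (a xor c) xor (b xor d)
  interchange = solve 4 (λ a b c d → (a :+ b) :+ (c :+ d) := (a :+ c) :+ (b :+ d)) refl

sum-∧ˡ : ∀ n a (f : Fin n → F₂) → a ∧ sum₂ n f ≡ sum₂ n (λ i → a ∧ f i)
sum-∧ˡ zero    a f = ∧-zeroʳ a
sum-∧ˡ (suc n) a f =
  trans (∧-distribˡ-xor a (f zero) _) (cong ((a ∧ f zero) xor_) (sum-∧ˡ n a (f ∘ suc)))

sum-swap : ∀ n m (f : Fin n → Fin m → F₂) →
           sum₂ n (λ i → sum₂ m (f i)) ≡ sum₂ m (λ j → sum₂ n (λ i → f i j))
sum-swap zero    m f = sym (sum-zero m)
sum-swap (suc n) m f =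
  trans (cong (sum₂ m (f zero) xor_) (sum-swap n m (f ∘ suc)))
        (sym (sum-xor m (f zero) (λ j → sum₂ n (λ i → f (suc i) j))))

sum-single : ∀ n (f : Fin n → F₂) c → (∀ j → j ≢ c → f j ≡ false) → sum₂ n f ≡ f c
sum-single (suc n) f zero    others = begin
  f zero xor sum₂ n (f ∘ suc)
    ≡⟨ cong (f zero xor_) (trans (sum-cong n (λ j → others (suc j) λ ())) (sum-zero n)) ⟩
  f zero xor false ≡⟨ xor-identityʳ (f zero) ⟩
  f zero ∎
sum-single (suc n) f (suc c) others =
  trans (cong (_xor sum₂ n (f ∘ suc)) (others zero λ ()))
        (sum-single n (f ∘ suc) c (λ j j≢c → others (suc j) (j≢c ∘ suc-injective)))

sum-true : ∀ n (f : Fin n → F₂) → sum₂ n f ≡ true → ∃ λ j → f j ≡ true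
sum-true (suc n) f sum≡1 with f zero in f₀
... | true  = zero , f₀
... | false = let (j , fj) = sum-true n (f ∘ suc) sum≡1 in suc j , fj

infixr 25 _·ᵥ_
infix  24 _·_
infix  23 _⊗_
infixl 22 _⊕_ _⊞_
infix  4  _≋_

_·_ : ∀ {n} → Vec₂ n → Vec₂ n → F₂
_·_ {n} u w = sum₂ n (λ j → u j ∧ w j)

_·ᵥ_ : ∀ {a n} → (Fin a → Vec₂ n) → Vec₂ n → Vec₂ a
(M ·ᵥ w) x = M x · w

_⊕_ : ∀ {n} → Vec₂ n → Vec₂ n → Vec₂ n
(u ⊕ w) x = u x xor w x

0ᵥ : ∀ {n} → Vec₂ n
0ᵥ _ = false

unit : ∀ {n} → Fin n → Vec₂ n
unit zero    zero    = true
unit zero    (suc _) = false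
unit (suc i) zero    = false
unit (suc i) (suc x) = unit i x

_⊗_ : ∀ {n} → Vec₂ n → Vec₂ n → Mat₂ n
(p ⊗ q) x y = p x ∧ q y

_⊞_ : ∀ {n} → Mat₂ n → Mat₂ n → Mat₂ n
(M ⊞ N) x y = M x y xor N x y

0ₘ : ∀ {n} → Mat₂ n
0ₘ _ _ = false

_≋_ : ∀ {n} → Mat₂ n → Mat₂ n → Set
M ≋ N = ∀ x y → M x y ≡ N x y

diag : ∀ {n} → Mat₂ n → Vec₂ n
diag M x = M x x

column : ∀ {n} → Mat₂ n → Fin n → Vec₂ n
column M j x = M x j

Symmetric : ∀ {n} → Mat₂ n → Set
Symmetric M = ∀ x y → M x y ≡ M y x

Alternating : ∀ {n} → Mat₂ n → Set
Alternating M = ∀ x → M x x ≡ false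

dot-comm : ∀ {n} (u w : Vec₂ n) → u · w ≡ w · u
dot-comm {n} u w = sum-cong n (λ j → ∧-comm (u j) (w j))

dot-congˡ : ∀ {n} {u u′ : Vec₂ n} (w : Vec₂ n) → u ≐ u′ → u · w ≡ u′ · w
dot-congˡ {n} w u≐u′ = sum-cong n (λ j → cong (_∧ w j) (u≐u′ j))

dot-congʳ : ∀ {n} (u : Vec₂ n) {w w′ : Vec₂ n} → w ≐ w′ → u · w ≡ u · w′
dot-congʳ {n} u w≐w′ = sum-cong n (λ j → cong (u j ∧_) (w≐w′ j))

dot-zeroʳ : ∀ {n} (u : Vec₂ n) → u · 0ᵥ ≡ false
dot-zeroʳ {n} u = trans (sum-cong n (λ j → ∧-zeroʳ (u j))) (sum-zero n)

dot-⊕ʳ : ∀ {n} (u v w : Vec₂ n) → u · (v ⊕ w) ≡ (u · v) xor (u · w)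
dot-⊕ʳ {n} u v w = trans (sum-cong n (λ j → ∧-distribˡ-xor (u j) (v j) (w j))) (sum-xor n _ _)

dot-scaleʳ : ∀ {n} (u w : Vec₂ n) a → u · (λ j → a ∧ w j) ≡ a ∧ (u · w)
dot-scaleʳ {n} u w a =
  trans (sum-cong n (λ j → rotate (u j) a (w j))) (sym (sum-∧ˡ n a (λ j → u j ∧ w j)))
  where
  rotate : ∀ b a c → b ∧ (a ∧ c) ≡ a ∧ (b ∧ c)
  rotate = solve 3 (λ b a c → b :* (a :* c) := a :* (b :* c)) refl

dot-unitʳ : ∀ {n} (u : Vec₂ n) i → u · unit i ≡ u i
dot-unitʳ {suc n} u zero = begin
  (u zero ∧ true) xor ((u ∘ suc) · 0ᵥ) ≡⟨ cong₂ _xor_ (∧-identityʳ (u zero)) (dot-zeroʳ (u ∘ suc)) ⟩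
  u zero xor false                    ≡⟨ xor-identityʳ (u zero) ⟩
  u zero                              ∎
dot-unitʳ {suc n} u (suc i) =
  trans (cong (_xor ((u ∘ suc) · unit i)) (∧-zeroʳ (u zero))) (dot-unitʳ (u ∘ suc) i)

dot-lincomb : ∀ {n} k (u : Vec₂ n) (c : Fin k → F₂) (b : Fin k → Vec₂ n) →
              u · lincomb k c b ≡ sum₂ k (λ j → c j ∧ (u · b j))
dot-lincomb {n} k u c b = begin
  sum₂ n (λ x → u x ∧ sum₂ k (λ j → c j ∧ b j x))
    ≡⟨ sum-cong n (λ x → sum-∧ˡ k (u x) _) ⟩
  sum₂ n (λ x → sum₂ k (λ j → u x ∧ (c j ∧ b j x)))
    ≡⟨ sum-swap n k _ ⟩
  sum₂ k (λ j → sum₂ n (λ x → u x ∧ (c j ∧ b j x)))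
    ≡⟨ sum-cong k (λ j → dot-scaleʳ u (b j) (c j)) ⟩
  sum₂ k (λ j → c j ∧ (u · b j)) ∎

lincomb-columns : ∀ {n} (M : Mat₂ n) d → lincomb n d (column M) ≐ M ·ᵥ d
lincomb-columns {n} M d x = sum-cong n (λ j → ∧-comm (d j) (M x j))

bilinear-symmetric : ∀ {n} (M : Mat₂ n) → Symmetric M → ∀ u w → u · (M ·ᵥ w) ≡ w · (M ·ᵥ u)
bilinear-symmetric {n} M M-sym u w = begin
  u · (M ·ᵥ w)                              ≡⟨ dot-congʳ u (λ x → sym (lincomb-columns M w x)) ⟩
  u · lincomb n w (column M)                ≡⟨ dot-lincomb n u w (column M) ⟩
  sum₂ n (λ y → w y ∧ (u · column M y))     ≡⟨ sum-cong n (λ y → cong (w y ∧_) (row-pairing y)) ⟩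
  w · (M ·ᵥ u)                              ∎
  where
  row-pairing : ∀ y → u · column M y ≡ M y · u
  row-pairing y = trans (dot-comm u (column M y)) (dot-congˡ u (λ x → M-sym x y))

-- Over F₂ the quadratic form of a symmetric matrix is linear: the cross terms
-- uₓ Mₓᵧ uᵧ and uᵧ Mᵧₓ uₓ cancel, leaving uᵀ M u = Σₓ uₓ Mₓₓ.
quadratic-diag : ∀ {n} (M : Mat₂ n) → Symmetric M → ∀ u → u · (M ·ᵥ u) ≡ u · diag M
quadratic-diag {zero}  M M-sym u = refl
quadratic-diag {suc n} M M-sym u = begin
  (u₀ ∧ ((M zero zero ∧ u₀) xor X)) xor (u′ · (λ l → (M (suc l) zero ∧ u₀) xor (M′ ·ᵥ u′) l))
    ≡⟨ cong ((u₀ ∧ ((M zero zero ∧ u₀) xor X)) xor_) (dot-⊕ʳ u′ _ (M′ ·ᵥ u′)) ⟩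
  (u₀ ∧ ((M zero zero ∧ u₀) xor X)) xor ((u′ · (λ l → M (suc l) zero ∧ u₀)) xor (u′ · (M′ ·ᵥ u′)))
    ≡⟨ cong (λ t → (u₀ ∧ ((M zero zero ∧ u₀) xor X)) xor (t xor (u′ · (M′ ·ᵥ u′)))) cross-term ⟩
  (u₀ ∧ ((M zero zero ∧ u₀) xor X)) xor ((X ∧ u₀) xor (u′ · (M′ ·ᵥ u′)))
    ≡⟨ cancel u₀ (M zero zero) X _ ⟩
  (u₀ ∧ (M zero zero ∧ u₀)) xor (u′ · (M′ ·ᵥ u′))
    ≡⟨ cong₂ _xor_ (idempotent u₀ (M zero zero)) (quadratic-diag M′ (λ x y → M-sym (suc x) (suc y)) u′) ⟩
  (u₀ ∧ M zero zero) xor (u′ · diag M′) ∎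
  where
  u₀ : F₂
  u₀ = u zero
  u′ : Vec₂ n
  u′ = u ∘ suc
  M′ : Mat₂ n
  M′ x y = M (suc x) (suc y)
  -- The first row (off the diagonal) paired with u′; it appears twice and cancels.
  X : F₂
  X = (λ j → M zero (suc j)) · u′
  cross-term : u′ · (λ l → M (suc l) zero ∧ u₀) ≡ X ∧ u₀
  cross-term = begin
    u′ · (λ l → M (suc l) zero ∧ u₀) ≡⟨ dot-congʳ u′ (λ l → trans (cong (_∧ u₀) (M-sym (suc l) zero)) (∧-comm _ u₀)) ⟩
    u′ · (λ l → u₀ ∧ M zero (suc l)) ≡⟨ dot-scaleʳ u′ _ u₀ ⟩
    u₀ ∧ (u′ · (λ l → M zero (suc l))) ≡⟨ cong₂ _∧_ refl (dot-comm u′ _) ⟩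
    u₀ ∧ X ≡⟨ ∧-comm u₀ X ⟩
    X ∧ u₀ ∎
  cancel : ∀ a m x q → (a ∧ ((m ∧ a) xor x)) xor ((x ∧ a) xor q) ≡ (a ∧ (m ∧ a)) xor q
  cancel = solve 4 (λ a m x q → (a :* ((m :* a) :+ x)) :+ ((x :* a) :+ q) := (a :* (m :* a)) :+ q) refl
  idempotent : ∀ a m → a ∧ (m ∧ a) ≡ a ∧ m
  idempotent true  m = ∧-identityʳ m
  idempotent false m = refl

·ᵥ-⊞⊗ : ∀ {n} (M : Mat₂ n) (p q w : Vec₂ n) x →
        ((M ⊞ p ⊗ q) ·ᵥ w) x ≡ (M ·ᵥ w) x xor ((q · w) ∧ p x)
·ᵥ-⊞⊗ {n} M p q w x = begin
  sum₂ n (λ y → (M x y xor (p x ∧ q y)) ∧ w y)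
    ≡⟨ sum-cong n (λ y → ∧-distribʳ-xor (w y) (M x y) (p x ∧ q y)) ⟩
  sum₂ n (λ y → (M x y ∧ w y) xor ((p x ∧ q y) ∧ w y))
    ≡⟨ sum-xor n _ _ ⟩
  (M ·ᵥ w) x xor sum₂ n (λ y → (p x ∧ q y) ∧ w y)
    ≡⟨ cong ((M ·ᵥ w) x xor_) (trans (sum-cong n (λ y → reassoc (p x) (q y) (w y))) (dot-scaleʳ q w (p x))) ⟩
  (M ·ᵥ w) x xor (p x ∧ (q · w))
    ≡⟨ cong ((M ·ᵥ w) x xor_) (∧-comm (p x) (q · w)) ⟩
  (M ·ᵥ w) x xor ((q · w) ∧ p x) ∎
  where
  reassoc : ∀ a b c → (a ∧ b) ∧ c ≡ b ∧ (a ∧ c)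
  reassoc = solve 3 (λ a b c → (a :* b) :* c := b :* (a :* c)) refl

⊞⊗-symmetric : ∀ {n} {M : Mat₂ n} (p : Vec₂ n) → Symmetric M → Symmetric (M ⊞ p ⊗ p)
⊞⊗-symmetric p M-sym x y = cong₂ _xor_ (M-sym x y) (∧-comm (p x) (p y))

col-≐ : ∀ {n} {M : Mat₂ n} {y y′ : Vec₂ n} → y ≐ y′ → InColSpace M y′ → InColSpace M y
col-≐ y≐y′ (c , y′≐Mc) = c , λ x → trans (y≐y′ x) (y′≐Mc x)

col-image : ∀ {n} (M : Mat₂ n) w → InColSpace M (M ·ᵥ w)
col-image M w = w , λ _ → refl

col-column : ∀ {n} (M : Mat₂ n) i → InColSpace M (column M i)
col-column M i = unit i , λ x → sym (dot-unitʳ (M x) i)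

col-zero : ∀ {n} (M : Mat₂ n) → InColSpace M 0ᵥ
col-zero M = 0ᵥ , λ x → sym (dot-zeroʳ (M x))

col-⊕ : ∀ {n} {M : Mat₂ n} {u w : Vec₂ n} → InColSpace M u → InColSpace M w → InColSpace M (u ⊕ w)
col-⊕ {M = M} (c , u≐) (d , w≐) =
  (c ⊕ d) , λ x → trans (cong₂ _xor_ (u≐ x) (w≐ x)) (sym (dot-⊕ʳ (M x) c d))

col-scale : ∀ {n} {M : Mat₂ n} {y : Vec₂ n} a → InColSpace M y → InColSpace M (λ x → a ∧ y x)
col-scale {M = M} a (c , y≐) = (λ j → a ∧ c j) , λ x → trans (cong (a ∧_) (y≐ x)) (sym (dot-scaleʳ (M x) c a))

col-lincomb : ∀ {n} {M : Mat₂ n} k (c : Fin k → F₂) (b : Fin k → Vec₂ n) →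
              (∀ j → InColSpace M (b j)) → InColSpace M (lincomb k c b)
col-lincomb {M = M} zero    c b b-col = col-zero M
col-lincomb         (suc k) c b b-col =
  col-⊕ (col-scale (c zero) (b-col zero)) (col-lincomb k (c ∘ suc) (b ∘ suc) (b-col ∘ suc))

col-⊞⊗ : ∀ {n} {M M′ : Mat₂ n} {p : Vec₂ n} (q : Vec₂ n) →
         (∀ {y} → InColSpace M′ y → InColSpace M y) → InColSpace M p →
         ∀ {y} → InColSpace (M′ ⊞ p ⊗ q) y → InColSpace M y
col-⊞⊗ {M′ = M′} {p} q col⊆ p-col (w , y≐) =
  col-≐ (λ x → trans (y≐ x) (·ᵥ-⊞⊗ M′ p q w x)) (col-⊕ (col⊆ (col-image M′ w)) (col-scale (q · w) p-col))

-- Live coordinates.  A 0/1-vector L bounds the rows of S that may be nonzero;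
-- pivoting clears rows and removes them from L, so count L measures progress.

Supported : ∀ {n} → Vec₂ n → Mat₂ n → Set
Supported L S = ∀ x y → S x y ≡ true → L x ≡ true

b2n : F₂ → ℕ
b2n true  = 1
b2n false = 0

count : ∀ {n} → Vec₂ n → ℕ
count {zero}  L = 0
count {suc n} L = b2n (L zero) + count (L ∘ suc)

count-all : ∀ n → count {n} (λ _ → true) ≡ n
count-all zero    = refl
count-all (suc n) = cong suc (count-all n)

remove : ∀ {n} → Fin n → Vec₂ n → Vec₂ n
remove i L x = not (unit i x) ∧ L x

unit-≢ : ∀ {n} {i x : Fin n} → i ≢ x → unit i x ≡ false
unit-≢ {i = zero}  {zero}  i≢x = ⊥-elim (i≢x refl)
unit-≢ {i = zero}  {suc x} i≢x = refl
unit-≢ {i = suc i} {zero}  i≢x = refl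
unit-≢ {i = suc i} {suc x} i≢x = unit-≢ (i≢x ∘ cong suc)

remove-≢ : ∀ {n} {i x : Fin n} (L : Vec₂ n) → i ≢ x → remove i L x ≡ L x
remove-≢ L i≢x = cong (λ t → not t ∧ L _) (unit-≢ i≢x)

count-remove : ∀ {n} (L : Vec₂ n) i → L i ≡ true → suc (count (remove i L)) ≡ count L
count-remove {suc n} L zero    Li rewrite Li = refl
count-remove {suc n} L (suc i) Li =
  trans (sym (+-suc (b2n (L zero)) _)) (cong (b2n (L zero) +_) (count-remove (L ∘ suc) i Li))

count-positive : ∀ {n} (L : Vec₂ n) {i} → L i ≡ true → 0 < count L
count-positive L {i} Li = subst (0 <_) (count-remove L i Li) (s≤s z≤n)

count-remove-≤ : ∀ {n f} (L : Vec₂ n) {i} → L i ≡ true → count L ≤ suc f → count (remove i L) ≤ f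
count-remove-≤ L {i} Li bound = ≤-pred (subst (_≤ _) (sym (count-remove L i Li)) bound)

supported-⊞⊗ : ∀ {n} {L p : Vec₂ n} {S : Mat₂ n} (q : Vec₂ n) → Supported L S →
               (∀ x → p x ≡ true → L x ≡ true) → Supported L (S ⊞ p ⊗ q)
supported-⊞⊗ {p = p} {S} q sup p⊆L x y entry with S x y in Sxy | p x in px
... | true  | _    = sup x y Sxy
... | false | true = p⊆L x px

supported-remove : ∀ {n} {L : Vec₂ n} {S : Mat₂ n} {i} → Supported L S →
                   (∀ y → S i y ≡ false) → Supported (remove i L) S
supported-remove {L = L} {S} {i} sup row-i x y Sxy with i ≟ᶠ x
... | yes refl with () ← trans (sym (row-i y)) Sxy
... | no  i≢x  = trans (remove-≢ L i≢x) (sup x y Sxy)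

-- The diagonal lemma

module DiagonalPivot {n} (S : Mat₂ n) (S-sym : Symmetric S) (i : Fin n) (Sii : S i i ≡ true) where

  s : Vec₂ n
  s = column S i

  S′ : Mat₂ n
  S′ = S ⊞ s ⊗ s

  S′-sym : Symmetric S′
  S′-sym = ⊞⊗-symmetric s S-sym

  S′-row : ∀ y → S′ i y ≡ false
  S′-row y = begin
    S i y xor (S i i ∧ S y i) ≡⟨ cong (λ t → S i y xor (t ∧ S y i)) Sii ⟩
    S i y xor S y i           ≡⟨ cong (S i y xor_) (S-sym y i) ⟩
    S i y xor S i y           ≡⟨ xor-same (S i y) ⟩
    false                     ∎

  diag-split : diag S ≐ diag S′ ⊕ s
  diag-split x = begin
    S x x                           ≡⟨ solve 2 (λ a b → a := (a :+ b) :+ b) refl (S x x) (s x) ⟩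
    (S x x xor s x) xor s x         ≡⟨ cong (λ t → (S x x xor t) xor s x) (sym (∧-idem (s x))) ⟩
    (S x x xor (s x ∧ s x)) xor s x ∎

-- By induction on the number of live rows: pivot while the diagonal is nonzero.
diag-col′ : ∀ {n} f (S : Mat₂ n) L → Symmetric S → Supported L S → count L ≤ f →
            InColSpace S (diag S)
diag-col′ f S L S-sym sup bound with any? (λ i → S i i ≟ true)
... | no no-pivot = col-≐ (λ x → ¬-not (λ Sxx → no-pivot (x , Sxx))) (col-zero S)
diag-col′ zero S L S-sym sup bound | yes (i , Sii) =
  ⊥-elim (n≮0 (<-≤-trans (count-positive L (sup i i Sii)) bound))
diag-col′ (suc f) S L S-sym sup bound | yes (i , Sii) =
  col-≐ diag-split (col-⊕ (col-⊞⊗ s id (col-column S i) diag-S′-col) (col-column S i))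
  where
  open DiagonalPivot S S-sym i Sii
  diag-S′-col : InColSpace S′ (diag S′)
  diag-S′-col = diag-col′ f S′ (remove i L) S′-sym
    (supported-remove (supported-⊞⊗ s sup (λ x → sup x i)) S′-row)
    (count-remove-≤ L (sup i i Sii) bound)

diag-col : ∀ {n} (S : Mat₂ n) → Symmetric S → InColSpace S (diag S)
diag-col {n} S S-sym =
  diag-col′ n S (λ _ → true) S-sym (λ _ _ _ → refl) (≤-reflexive (count-all n))

-- Hyperbolic decomposition of an alternating matrix

hyperbolic : ∀ {n} → List (Vec₂ n × Vec₂ n) → Mat₂ n
hyperbolic []            = 0ₘ
hyperbolic ((a , b) ∷ P) = (a ⊗ b ⊞ b ⊗ a) ⊞ hyperbolic P

ColPair : ∀ {n} → Mat₂ n → Vec₂ n × Vec₂ n → Set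
ColPair S (a , b) = InColSpace S a × InColSpace S b

module HyperbolicPivot {n} (S : Mat₂ n) (S-sym : Symmetric S) (S-alt : Alternating S)
                       (i j : Fin n) (Sij : S i j ≡ true) where

  a b : Vec₂ n
  a = column S i
  b = column S j

  S₂ : Mat₂ n
  S₂ = S ⊞ a ⊗ b ⊞ b ⊗ a

  split : S ≋ (a ⊗ b ⊞ b ⊗ a) ⊞ S₂
  split x y = solve 3 (λ s p q → s := (p :+ q) :+ ((s :+ p) :+ q)) refl
                (S x y) (a x ∧ b y) (b x ∧ a y)

  S₂-sym : Symmetric S₂
  S₂-sym x y = begin
    (S x y xor (a x ∧ b y)) xor (b x ∧ a y) ≡⟨ cong (λ t → (t xor (a x ∧ b y)) xor (b x ∧ a y)) (S-sym x y) ⟩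
    (S y x xor (a x ∧ b y)) xor (b x ∧ a y) ≡⟨ swap (S y x) (a x) (b y) (b x) (a y) ⟩
    (S y x xor (a y ∧ b x)) xor (b y ∧ a x) ∎
    where
    swap : ∀ s p q r t → (s xor (p ∧ q)) xor (r ∧ t) ≡ (s xor (t ∧ r)) xor (q ∧ p)
    swap = solve 5 (λ s p q r t → (s :+ (p :* q)) :+ (r :* t) := (s :+ (t :* r)) :+ (q :* p)) refl

  S₂-alt : Alternating S₂
  S₂-alt x = trans (cong (λ t → (t xor (a x ∧ b x)) xor (b x ∧ a x)) (S-alt x))
                   (solve 2 (λ p q → (con false :+ (p :* q)) :+ (q :* p) := con false) refl (a x) (b x))

  S₂-row-i : ∀ y → S₂ i y ≡ false
  S₂-row-i y = begin
    (S i y xor (S i i ∧ S y j)) xor (S i j ∧ S y i) ≡⟨ cong₂ (λ p q → (S i y xor (p ∧ S y j)) xor (q ∧ S y i)) (S-alt i) Sij ⟩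
    (S i y xor false) xor S y i                     ≡⟨ cong₂ _xor_ (xor-identityʳ (S i y)) (S-sym y i) ⟩
    S i y xor S i y                                 ≡⟨ xor-same (S i y) ⟩
    false                                           ∎

  S₂-row-j : ∀ y → S₂ j y ≡ false
  S₂-row-j y = begin
    (S j y xor (S j i ∧ S y j)) xor (S j j ∧ S y i) ≡⟨ cong₂ (λ p q → (S j y xor (p ∧ S y j)) xor (q ∧ S y i)) (trans (S-sym j i) Sij) (S-alt j) ⟩
    (S j y xor S y j) xor false                     ≡⟨ xor-identityʳ _ ⟩
    S j y xor S y j                                 ≡⟨ cong (S j y xor_) (S-sym y j) ⟩
    S j y xor S j y                                 ≡⟨ xor-same (S j y) ⟩
    false                                           ∎

  -- Columns of S pair with a kernel vector to zero, so the kernel survives.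
  S₂-kernel : ∀ {μ} → S ·ᵥ μ ≐ 0ᵥ → S₂ ·ᵥ μ ≐ 0ᵥ
  S₂-kernel {μ} ker x = begin
    (S₂ ·ᵥ μ) x                                         ≡⟨ ·ᵥ-⊞⊗ (S ⊞ a ⊗ b) b a μ x ⟩
    ((S ⊞ a ⊗ b) ·ᵥ μ) x xor ((a · μ) ∧ b x)            ≡⟨ cong (_xor ((a · μ) ∧ b x)) (·ᵥ-⊞⊗ S a b μ x) ⟩
    ((S ·ᵥ μ) x xor ((b · μ) ∧ a x)) xor ((a · μ) ∧ b x) ≡⟨ cong₂ (λ p q → ((S ·ᵥ μ) x xor (p ∧ a x)) xor (q ∧ b x)) (column-pairing j) (column-pairing i) ⟩
    ((S ·ᵥ μ) x xor (false ∧ a x)) xor (false ∧ b x)    ≡⟨ cong (λ t → (t xor false) xor false) (ker x) ⟩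
    false                                               ∎
    where
    column-pairing : ∀ l → column S l · μ ≡ false
    column-pairing l = trans (dot-congˡ μ (λ y → S-sym y l)) (ker l)

  S₂-col : ∀ {y} → InColSpace S₂ y → InColSpace S y
  S₂-col = col-⊞⊗ a (col-⊞⊗ b id (col-column S i)) (col-column S j)

  i≢j : i ≢ j
  i≢j refl with () ← trans (sym (S-alt i)) Sij

-- Fix a kernel vector μ with μ_c = 1.  An alternating S with S μ = 0 whose
-- rows lie in a support L ∋ c is a sum of hyperbolic pairs from col S, at
-- most (count L - 1)/2 of them: pivot on entries Sᵢⱼ = 1 with i, j ≠ c while
-- they exist, clearing two live rows each time.
module HyperbolicDecomposition {n} (μ : Vec₂ n) (c : Fin n) (μc : μ c ≡ true) where

  Decomposition : Mat₂ n → Vec₂ n → Set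
  Decomposition S L = Σ (List (Vec₂ n × Vec₂ n)) λ P →
    S ≋ hyperbolic P × All (ColPair S) P × suc (2 * length P) ≤ count L

  -- Row x of S μ = 0 reads S x c = Σ_{l ≠ c} S x l μₗ.
  kernel-column : ∀ {S : Mat₂ n} → S ·ᵥ μ ≐ 0ᵥ → ∀ x → (∀ l → l ≢ c → S x l ≡ false) → S x c ≡ false
  kernel-column {S} ker x off-c = begin
    S x c          ≡⟨ sym (∧-identityʳ (S x c)) ⟩
    S x c ∧ true   ≡⟨ cong (S x c ∧_) (sym μc) ⟩
    S x c ∧ μ c    ≡⟨ sym (sum-single n (λ l → S x l ∧ μ l) c (λ l l≢c → cong (_∧ μ l) (off-c l l≢c))) ⟩
    (S ·ᵥ μ) x     ≡⟨ ker x ⟩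
    false          ∎

  -- Without pivots off row and column c, the kernel vector forces S = 0.
  vanishes : ∀ {S : Mat₂ n} → Symmetric S → Alternating S → S ·ᵥ μ ≐ 0ᵥ →
             (∀ x y → x ≢ c → y ≢ c → S x y ≡ false) → S ≋ 0ₘ
  vanishes {S} S-sym S-alt ker off-c x y with x ≟ᶠ c | y ≟ᶠ c
  ... | yes refl | yes refl = S-alt c
  ... | yes refl | no y≢c   = trans (S-sym c y) (kernel-column ker y (λ l l≢c → off-c y l y≢c l≢c))
  ... | no x≢c   | yes refl = kernel-column ker x (λ l l≢c → off-c x l x≢c l≢c)
  ... | no x≢c   | no y≢c   = off-c x y x≢c y≢c

  decompose : ∀ f (S : Mat₂ n) L → Symmetric S → Alternating S → S ·ᵥ μ ≐ 0ᵥ →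
              Supported L S → L c ≡ true → count L ≤ f → Decomposition S L
  decompose zero S L _ _ _ _ Lc bound = ⊥-elim (n≮0 (<-≤-trans (count-positive L Lc) bound))
  decompose (suc f) S L S-sym S-alt ker sup Lc bound
    with any? (λ i → any? (λ j → ¬? (i ≟ᶠ c) ×-dec ¬? (j ≟ᶠ c) ×-dec S i j ≟ true))
  ... | no no-pivot =
    [] , vanishes S-sym S-alt ker (λ x y x≢c y≢c → ¬-not (λ Sxy → no-pivot (x , y , x≢c , y≢c , Sxy)))
       , [] , count-positive L Lc
  ... | yes (i , j , i≢c , j≢c , Sij) =
    let (P , S₂≋P , P-col , P-bound) = decompose f S₂ L₂ S₂-sym S₂-alt (S₂-kernel ker) sup₂ L₂c bound₂
    in (a , b) ∷ P
       , (λ x y → trans (split x y) (cong ((a ⊗ b ⊞ b ⊗ a) x y xor_) (S₂≋P x y)))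
       , (col-column S i , col-column S j) ∷ All.map (λ (ca , cb) → S₂-col ca , S₂-col cb) P-col
       , subst (λ t → suc t ≤ count L) (sym (*-suc 2 (length P)))
               (subst (suc (suc (suc (2 * length P))) ≤_) count-L (s≤s (s≤s P-bound)))
    where
    open HyperbolicPivot S S-sym S-alt i j Sij
    L₁ L₂ : Vec₂ n
    L₁ = remove i L
    L₂ = remove j L₁
    L₁j : L₁ j ≡ true
    L₁j = trans (remove-≢ L i≢j) (sup j i (trans (S-sym j i) Sij))
    count-L : suc (suc (count L₂)) ≡ count L
    count-L = trans (cong suc (count-remove L₁ j L₁j)) (count-remove L i (sup i j Sij))
    sup₂ : Supported L₂ S₂
    sup₂ = supported-remove (supported-remove (supported-⊞⊗ a (supported-⊞⊗ b sup (λ x → sup x i)) (λ x → sup x j)) S₂-row-i) S₂-row-j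
    L₂c : L₂ c ≡ true
    L₂c = trans (remove-≢ L₁ j≢c) (trans (remove-≢ L i≢c) Lc)
    bound₂ : count L₂ ≤ f
    bound₂ = ≤-trans (n≤1+n (count L₂)) (≤-pred (subst (_≤ suc f) (sym count-L) bound))

-- Sums of squares

squares : ∀ {k} n → (Fin n → Vec₂ k) → Mat₂ k
squares n z x y = sum₂ n (λ i → z i x ∧ z i y)

Σ⊗ : ∀ {k} → List (Vec₂ k) → Mat₂ k
Σ⊗ Z = squares (length Z) (lookup Z)

dot-squares : ∀ {k} n (z : Fin n → Vec₂ k) (u w : Vec₂ k) →
              u · (squares n z ·ᵥ w) ≡ sum₂ n (λ i → (u · z i) ∧ (w · z i))
dot-squares {k} n z u w = begin
  u · (squares n z ·ᵥ w)                     ≡⟨ dot-congʳ u row ⟩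
  u · lincomb n (λ i → z i · w) z            ≡⟨ dot-lincomb n u (λ i → z i · w) z ⟩
  sum₂ n (λ i → (z i · w) ∧ (u · z i))       ≡⟨ sum-cong n (λ i → trans (∧-comm (z i · w) (u · z i)) (cong ((u · z i) ∧_) (dot-comm (z i) w))) ⟩
  sum₂ n (λ i → (u · z i) ∧ (w · z i))       ∎
  where
  row : squares n z ·ᵥ w ≐ lincomb n (λ i → z i · w) z
  row x = begin
    lincomb n (λ i → z i x) z · w              ≡⟨ dot-comm _ w ⟩
    w · lincomb n (λ i → z i x) z              ≡⟨ dot-lincomb n w (λ i → z i x) z ⟩
    sum₂ n (λ i → z i x ∧ (w · z i))           ≡⟨ sum-cong n (λ i → trans (∧-comm (z i x) (w · z i)) (cong (_∧ z i x) (dot-comm w (z i)))) ⟩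
    sum₂ n (λ i → (z i · w) ∧ z i x)           ∎

-- A hyperbolic pair is a sum of three squares: a bᵀ + b aᵀ = (a+b)(a+b)ᵀ + a aᵀ + b bᵀ.
triples : ∀ {k} → List (Vec₂ k × Vec₂ k) → List (Vec₂ k)
triples []            = []
triples ((a , b) ∷ P) = (a ⊕ b) ∷ a ∷ b ∷ triples P

hyperbolic-squares : ∀ {k} (P : List (Vec₂ k × Vec₂ k)) → hyperbolic P ≋ Σ⊗ (triples P)
hyperbolic-squares []            x y = refl
hyperbolic-squares ((a , b) ∷ P) x y =
  trans (cong ((a ⊗ b ⊞ b ⊗ a) x y xor_) (hyperbolic-squares P x y))
        (three-squares (a x) (a y) (b x) (b y) (Σ⊗ (triples P) x y))
  where
  three-squares : ∀ ax ay bx by r →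
    ((ax ∧ by) xor (bx ∧ ay)) xor r ≡ ((ax xor bx) ∧ (ay xor by)) xor ((ax ∧ ay) xor ((bx ∧ by) xor r))
  three-squares = solve 5 (λ ax ay bx by r →
    ((ax :* by) :+ (bx :* ay)) :+ r := ((ax :+ bx) :* (ay :+ by)) :+ ((ax :* ay) :+ ((bx :* by) :+ r))) refl

triples-length : ∀ {k} (P : List (Vec₂ k × Vec₂ k)) → length (triples P) ≡ 3 * length P
triples-length []      = refl
triples-length (_ ∷ P) = trans (cong (3 +_) (triples-length P)) (sym (*-suc 3 (length P)))

triples-col : ∀ {k} {S : Mat₂ k} (P : List (Vec₂ k × Vec₂ k)) → All (ColPair S) P → All (InColSpace S) (triples P)
triples-col []      []                  = []
triples-col (_ ∷ P) ((ca , cb) ∷ P-col) = col-⊕ ca cb ∷ ca ∷ cb ∷ triples-col P P-col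

parity : ℕ → F₂
parity zero    = false
parity (suc n) = not (parity n)

parity-odd  : ∀ n → parity n ≡ true  → Odd n
parity-even : ∀ n → parity n ≡ false → ∃ λ j → n ≡ 2 * j
parity-odd (suc n) odd with parity n in p
... | false = let (j , n≡2j) = parity-even n p in j , trans (cong suc n≡2j) (+-comm 1 (2 * j))
parity-even zero    even = 0 , refl
parity-even (suc n) even with parity n in p
... | true = let (j , n≡2j+1) = parity-odd n p in
             suc j , trans (cong suc (trans n≡2j+1 (+-comm (2 * j) 1))) (sym (*-suc 2 j))

pad-odd : ∀ {k} {P : Vec₂ k → Set} (Y : List (Vec₂ k)) → P 0ᵥ → All P Y →
          Σ (List (Vec₂ k)) λ Y′ → parity (length Y′) ≡ true × length Y′ ≤ suc (length Y)
                                  × Σ⊗ Y′ ≋ Σ⊗ Y × All P Y′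
pad-odd Y P0 PY with parity (length Y) in p
... | true  = Y , p , n≤1+n (length Y) , (λ _ _ → refl) , PY
... | false = 0ᵥ ∷ Y , cong not p , ≤-refl , (λ _ _ → refl) , P0 ∷ PY

total : ∀ {k} → List (Vec₂ k) → Vec₂ k
total Y x = sum₂ (length Y) (λ i → lookup Y i x)

squares-shift : ∀ {k} (s : Vec₂ k) (Y : List (Vec₂ k)) x y →
  Σ⊗ (map (s ⊕_) Y) x y ≡
  ((parity (length Y) ∧ (s x ∧ s y)) xor ((s x ∧ total Y y) xor (total Y x ∧ s y))) xor Σ⊗ Y x y
squares-shift s []      x y = solve 2 (λ a b →
  con false := ((con false :* (a :* b)) :+ ((a :* con false) :+ (con false :* b))) :+ con false) refl (s x) (s y)
squares-shift s (v ∷ Y) x y =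
  trans (cong (((s x xor v x) ∧ (s y xor v y)) xor_) (squares-shift s Y x y))
        (expand (s x) (s y) (v x) (v y) (parity (length Y)) (total Y x) (total Y y) (Σ⊗ Y x y))
  where
  expand : ∀ sx sy vx vy p tx ty q →
    ((sx xor vx) ∧ (sy xor vy)) xor (((p ∧ (sx ∧ sy)) xor ((sx ∧ ty) xor (tx ∧ sy))) xor q)
    ≡ ((not p ∧ (sx ∧ sy)) xor ((sx ∧ (vy xor ty)) xor ((vx xor tx) ∧ sy))) xor ((vx ∧ vy) xor q)
  expand = solve 8 (λ sx sy vx vy p tx ty q →
    ((sx :+ vx) :* (sy :+ vy)) :+ (((p :* (sx :* sy)) :+ ((sx :* ty) :+ (tx :* sy))) :+ q)
    := (((con true :+ p) :* (sx :* sy)) :+ ((sx :* (vy :+ ty)) :+ ((vx :+ tx) :* sy))) :+ ((vx :* vy) :+ q)) refl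

-- For an odd number of squares with vanishing diagonal, t = 0 and the shift adds s sᵀ.
odd-shift : ∀ {k} (s : Vec₂ k) (Y : List (Vec₂ k)) → parity (length Y) ≡ true →
            Alternating (Σ⊗ Y) → Σ⊗ (map (s ⊕_) Y) ≋ s ⊗ s ⊞ Σ⊗ Y
odd-shift s Y odd alt x y = begin
  Σ⊗ (map (s ⊕_) Y) x y
    ≡⟨ squares-shift s Y x y ⟩
  ((parity (length Y) ∧ (s x ∧ s y)) xor ((s x ∧ total Y y) xor (total Y x ∧ s y))) xor Σ⊗ Y x y
    ≡⟨ cong₂ (λ tx ty → ((parity (length Y) ∧ (s x ∧ s y)) xor ((s x ∧ ty) xor (tx ∧ s y))) xor Σ⊗ Y x y) (total-zero x) (total-zero y) ⟩
  ((parity (length Y) ∧ (s x ∧ s y)) xor ((s x ∧ false) xor (false ∧ s y))) xor Σ⊗ Y x y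
    ≡⟨ cong (λ p → ((p ∧ (s x ∧ s y)) xor ((s x ∧ false) xor (false ∧ s y))) xor Σ⊗ Y x y) odd ⟩
  ((s x ∧ s y) xor ((s x ∧ false) xor false)) xor Σ⊗ Y x y
    ≡⟨ cong (λ t → ((s x ∧ s y) xor (t xor false)) xor Σ⊗ Y x y) (∧-zeroʳ (s x)) ⟩
  ((s x ∧ s y) xor false) xor Σ⊗ Y x y
    ≡⟨ cong (_xor Σ⊗ Y x y) (xor-identityʳ (s x ∧ s y)) ⟩
  (s x ∧ s y) xor Σ⊗ Y x y ∎
  where
  -- t = Σ yᵢ is the diagonal of Σ yᵢ yᵢᵀ, since yᵢ(x)² = yᵢ(x).
  total-zero : ∀ x → total Y x ≡ false
  total-zero x = trans (sum-cong (length Y) (λ i → sym (∧-idem (lookup Y i x)))) (alt x)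

-- Counting: p pairs give at most 3p + 1 squares, and 2p + 1 ≤ k gives 2 (3p + 1) < 3k + 2.
square-count-bound : ∀ {p k n} → suc (2 * p) ≤ k → n ≤ suc (3 * p) → 2 * n < 3 * k + 2
square-count-bound {p} {k} pairs squares =
  ≤-trans (s≤s (*-monoʳ-≤ 2 squares))
    (≤-trans (≤-reflexive (regroup p)) (≤-trans (*-monoʳ-≤ 3 pairs) (m≤m+n (3 * k) 2)))
  where
  regroup : ∀ p → suc (2 * suc (3 * p)) ≡ 3 * suc (2 * p)
  regroup = solve-∀

alternating-odd-squares : ∀ {k} {T : Mat₂ k} (μ : Vec₂ k) c → μ c ≡ true →
  Symmetric T → Alternating T → T ·ᵥ μ ≐ 0ᵥ →
  Σ (List (Vec₂ k)) λ Y → parity (length Y) ≡ true × 2 * length Y < 3 * k + 2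
                        × T ≋ Σ⊗ Y × All (InColSpace T) Y
alternating-odd-squares {k} {T} μ c μc T-sym T-alt ker =
  let (P , T≋P , P-col , P-bound) = decompose k T (λ _ → true) T-sym T-alt ker (λ _ _ _ → refl) refl
                                              (≤-reflexive (count-all k))
      (Y , odd , Y-length , Y≋ , Y-col) = pad-odd (triples P) (col-zero T) (triples-col P P-col)
  in Y , odd
       , square-count-bound {p = length P} (subst (suc (2 * length P) ≤_) (count-all k) P-bound)
                                           (subst (λ t → length Y ≤ suc t) (triples-length P) Y-length)
       , (λ x y → trans (T≋P x y) (trans (hyperbolic-squares P x y) (sym (Y≋ x y))))
       , Y-col
  where open HyperbolicDecomposition μ c μc

OddSquareDecomposition : ∀ {k} → Mat₂ k → Vec₂ k → Set
OddSquareDecomposition {k} S μ = Σ (List (Vec₂ k)) λ Z →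
  Odd (length Z) × 2 * length Z < 3 * k + 2 × S ≋ Σ⊗ Z
  × All (λ z → μ · z ≡ true × InColSpace S z) Z

module OddDecomposition {k} (S : Mat₂ k) (μ : Vec₂ k) (S-sym : Symmetric S)
                        (diag≐Sμ : diag S ≐ S ·ᵥ μ) (μSμ : μ · (S ·ᵥ μ) ≡ true) where

  s : Vec₂ k
  s = S ·ᵥ μ

  S′ : Mat₂ k
  S′ = S ⊞ s ⊗ s

  S′-sym : Symmetric S′
  S′-sym = ⊞⊗-symmetric s S-sym

  S′-alt : Alternating S′
  S′-alt x = trans (cong₂ _xor_ (diag≐Sμ x) (∧-idem (s x))) (xor-same (s x))

  S′-kernel : S′ ·ᵥ μ ≐ 0ᵥ
  S′-kernel x = begin
    (S′ ·ᵥ μ) x              ≡⟨ ·ᵥ-⊞⊗ S s s μ x ⟩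
    s x xor ((s · μ) ∧ s x)  ≡⟨ cong (λ t → s x xor (t ∧ s x)) (trans (dot-comm s μ) μSμ) ⟩
    s x xor s x              ≡⟨ xor-same (s x) ⟩
    false                    ∎

  shifted : ∀ {y} → InColSpace S′ y → μ · (s ⊕ y) ≡ true × InColSpace S (s ⊕ y)
  shifted {y} y-col@(w , y≐S′w) = pairing , col-⊕ (col-image S μ) (col-⊞⊗ s id (col-image S μ) y-col)
    where
    pairing : μ · (s ⊕ y) ≡ true
    pairing = begin
      μ · (s ⊕ y)              ≡⟨ dot-⊕ʳ μ s y ⟩
      (μ · s) xor (μ · y)      ≡⟨ cong₂ _xor_ μSμ (dot-congʳ μ y≐S′w) ⟩
      true xor (μ · (S′ ·ᵥ w)) ≡⟨ cong (true xor_) (bilinear-symmetric S′ S′-sym μ w) ⟩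
      true xor (w · (S′ ·ᵥ μ)) ≡⟨ cong (true xor_) (trans (dot-congʳ w S′-kernel) (dot-zeroʳ w)) ⟩
      true                     ∎

  shifted-squares : ∀ Y → parity (length Y) ≡ true → S′ ≋ Σ⊗ Y → S ≋ Σ⊗ (map (s ⊕_) Y)
  shifted-squares Y odd S′≋Y x y = begin
    S x y                        ≡⟨ solve 2 (λ a p → a := p :+ (a :+ p)) refl (S x y) (s x ∧ s y) ⟩
    (s x ∧ s y) xor S′ x y       ≡⟨ cong ((s x ∧ s y) xor_) (S′≋Y x y) ⟩
    (s x ∧ s y) xor Σ⊗ Y x y     ≡⟨ sym (odd-shift s Y odd (λ x → trans (sym (S′≋Y x x)) (S′-alt x)) x y) ⟩
    Σ⊗ (map (s ⊕_) Y) x y        ∎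

  odd-square-decomposition : OddSquareDecomposition S μ
  odd-square-decomposition =
    let (c , μc∧sc) = sum-true k (λ j → μ j ∧ s j) μSμ
        (Y , odd , bound , S′≋Y , Y-col) =
          alternating-odd-squares μ c (∧-conicalˡ (μ c) (s c) μc∧sc) S′-sym S′-alt S′-kernel
    in map (s ⊕_) Y , subst Odd (sym (length-map (s ⊕_) Y)) (parity-odd (length Y) odd)
                    , subst (λ n → 2 * n < 3 * k + 2) (sym (length-map (s ⊕_) Y)) bound
                    , shifted-squares Y odd S′≋Y , map⁺ (All.map shifted Y-col)

-- The Gram factorisation A = U S Uᵀ

record GramFactorisation {N} (A : Mat₂ N) (k : ℕ) : Set where
  field
    U            : Fin N → Vec₂ k
    S            : Mat₂ k
    S-sym        : Symmetric S
    factor       : ∀ x y → A x y ≡ U x · (S ·ᵥ U y)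
    US-injective : ∀ d → U ·ᵥ S ·ᵥ d ≐ 0ᵥ → d ≐ 0ᵥ
    US-col       : ∀ d → InColSpace A (U ·ᵥ S ·ᵥ d)

-- From a basis bⱼ = A gⱼ of col A: U x are the coordinates of column x of A,
-- and S is the Gram matrix Sₗⱼ = bₗ · gⱼ = gₗᵀ A gⱼ.
module GramConstruction {N k} (A : Mat₂ N) (A-sym : Symmetric A) (b : Fin k → Vec₂ N)
                        (b-indep : LinIndep k b) (b-col : ∀ j → InColSpace A (b j))
                        (b-span : ∀ y → InColSpace A y → InSpan k b y) where

  g : Fin k → Vec₂ N
  g j = proj₁ (b-col j)

  b≐Ag : ∀ j → b j ≐ A ·ᵥ g j
  b≐Ag j = proj₂ (b-col j)

  U : Fin N → Vec₂ k
  U y = proj₁ (b-span (column A y) (col-column A y))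

  column-coords : ∀ y → column A y ≐ lincomb k (U y) b
  column-coords y = proj₂ (b-span (column A y) (col-column A y))

  S : Mat₂ k
  S l j = b l · g j

  -- bⱼ = U (column j of S): expand the rows of A = Aᵀ in the basis.
  basis-coords : ∀ j x → b j x ≡ U x · column S j
  basis-coords j x = begin
    b j x                               ≡⟨ b≐Ag j x ⟩
    A x · g j                           ≡⟨ dot-congˡ (g j) (λ y → trans (A-sym x y) (column-coords x y)) ⟩
    lincomb k (U x) b · g j             ≡⟨ dot-comm _ (g j) ⟩
    g j · lincomb k (U x) b             ≡⟨ dot-lincomb k (g j) (U x) b ⟩
    sum₂ k (λ l → U x l ∧ (g j · b l))  ≡⟨ sum-cong k (λ l → cong (U x l ∧_) (dot-comm (g j) (b l))) ⟩
    U x · column S j                    ∎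

  US-lincomb : ∀ d → U ·ᵥ S ·ᵥ d ≐ lincomb k d b
  US-lincomb d x = begin
    U x · (S ·ᵥ d)                          ≡⟨ dot-congʳ (U x) (λ l → sym (lincomb-columns S d l)) ⟩
    U x · lincomb k d (column S)            ≡⟨ dot-lincomb k (U x) d (column S) ⟩
    sum₂ k (λ j → d j ∧ (U x · column S j)) ≡⟨ sum-cong k (λ j → cong (d j ∧_) (sym (basis-coords j x))) ⟩
    lincomb k d b x                         ∎

  S-sym : Symmetric S
  S-sym l j = begin
    b l · g j            ≡⟨ dot-congˡ (g j) (b≐Ag l) ⟩
    (A ·ᵥ g l) · g j     ≡⟨ dot-comm _ (g j) ⟩
    g j · (A ·ᵥ g l)     ≡⟨ bilinear-symmetric A A-sym (g j) (g l) ⟩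
    g l · (A ·ᵥ g j)     ≡⟨ dot-congʳ (g l) (λ x → sym (b≐Ag j x)) ⟩
    g l · b j            ≡⟨ dot-comm (g l) (b j) ⟩
    b j · g l            ∎

gram-factorisation : ∀ {N k} (A : Mat₂ N) → Symmetric A → HasRank A k → GramFactorisation A k
gram-factorisation {k = k} A A-sym (b , b-indep , b-col , b-span) = record
  { U            = U
  ; S            = S
  ; S-sym        = S-sym
  ; factor       = λ x y → trans (column-coords y x) (sym (US-lincomb (U y) x))
  ; US-injective = λ d US≐0 → b-indep d (λ x → trans (sym (US-lincomb d x)) (US≐0 x))
  ; US-col       = λ d → col-≐ (US-lincomb d) (col-lincomb k d b b-col)
  }
  where open GramConstruction A A-sym b b-indep b-col b-span

-- Pseudo-quadratic matrices

pq-diagonal : ∀ {m} {A : Mat₂ (suc m)} → PseudoQuadratic A → ∀ x → A x x ≡ A x zero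
pq-diagonal pq zero    = refl
pq-diagonal pq (suc i) = sym (proj₂ (proj₂ (proj₂ pq)) i)

module PseudoQuadraticGram {m k} {A : Mat₂ (suc m)} (pq : PseudoQuadratic A) (G : GramFactorisation A k) where
  open GramFactorisation G

  μ : Vec₂ k
  μ = U zero

  gram-unit : μ · (S ·ᵥ μ) ≡ true
  gram-unit = trans (sym (factor zero zero)) (proj₁ (proj₂ pq))

  -- diag S = S w for some w; U S (w + μ) vanishes, so w = μ by injectivity.
  gram-diag : diag S ≐ S ·ᵥ μ
  gram-diag x = trans (w≐Sw x) (dot-congʳ (S x) w≐μ)
    where
    w : Vec₂ k
    w = proj₁ (diag-col S S-sym)
    w≐Sw : diag S ≐ S ·ᵥ w
    w≐Sw = proj₂ (diag-col S S-sym)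
    US[w+μ]≐0 : U ·ᵥ S ·ᵥ (w ⊕ μ) ≐ 0ᵥ
    US[w+μ]≐0 y = begin
      U y · (S ·ᵥ (w ⊕ μ))                    ≡⟨ dot-congʳ (U y) (λ l → dot-⊕ʳ (S l) w μ) ⟩
      U y · ((S ·ᵥ w) ⊕ (S ·ᵥ μ))             ≡⟨ dot-⊕ʳ (U y) (S ·ᵥ w) (S ·ᵥ μ) ⟩
      (U y · (S ·ᵥ w)) xor (U y · (S ·ᵥ μ))   ≡⟨ cong₂ _xor_ (dot-congʳ (U y) (λ l → sym (w≐Sw l))) (sym (factor y zero)) ⟩
      (U y · diag S) xor A y zero             ≡⟨ cong (_xor A y zero) (sym (quadratic-diag S S-sym (U y))) ⟩
      (U y · (S ·ᵥ U y)) xor A y zero         ≡⟨ cong (_xor A y zero) (sym (factor y y)) ⟩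
      A y y xor A y zero                      ≡⟨ cong (_xor A y zero) (pq-diagonal pq y) ⟩
      A y zero xor A y zero                   ≡⟨ xor-same (A y zero) ⟩
      false                                   ∎
    w≐μ : w ≐ μ
    w≐μ j = xor-false (US-injective (w ⊕ μ) US[w+μ]≐0 j)
      where
      xor-false : ∀ {p q} → p xor q ≡ false → p ≡ q
      xor-false {true}  {true}  _ = refl
      xor-false {false} {false} _ = refl

-- D₁ maps col A into col D₁(A) when A is pseudo-quadratic: below the first
-- row, the first column of A is the diagonal of D₁(A), in col D₁(A).
D₁-col : ∀ {m} {A : Mat₂ (suc m)} {y} → PseudoQuadratic A → InColSpace A y → InColSpace (D₁ᴹ A) (D₁ y)
D₁-col {A = A} {y} (A-sym , _ , _ , first-column) (c , y≐Ac) =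
  col-≐ D₁y≐ (col-⊕ (col-scale (c zero) (diag-col B (λ x y → A-sym (suc x) (suc y)))) (col-image B (D₁ c)))
  where
  B : Mat₂ _
  B = D₁ᴹ A
  D₁y≐ : D₁ y ≐ (λ i → c zero ∧ diag B i) ⊕ (B ·ᵥ D₁ c)
  D₁y≐ i = trans (y≐Ac (suc i)) (cong (_xor (B ·ᵥ D₁ c) i) (trans (∧-comm _ (c zero)) (cong (c zero ∧_) (first-column i))))

module PushForward {m k} {A : Mat₂ (suc m)} (pq : PseudoQuadratic A) (G : GramFactorisation A k) where
  open GramFactorisation G

  pushed : (Z : List (Vec₂ k)) → Fin (length Z) → Vec₂ (suc m)
  pushed Z i = U ·ᵥ lookup Z i

  pushed-squares : ∀ Z → S ≋ Σ⊗ Z → ∀ a c → A a c ≡ sum₂ (length Z) (λ i → pushed Z i a ∧ pushed Z i c)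
  pushed-squares Z S≋Z a c = begin
    A a c                         ≡⟨ factor a c ⟩
    U a · (S ·ᵥ U c)              ≡⟨ dot-congʳ (U a) (λ x → dot-congˡ (U c) (S≋Z x)) ⟩
    U a · (Σ⊗ Z ·ᵥ U c)           ≡⟨ dot-squares (length Z) (lookup Z) (U a) (U c) ⟩
    sum₂ (length Z) (λ i → pushed Z i a ∧ pushed Z i c) ∎

  -- The first coordinate of U z is U₁ · z.
  pushed-first : ∀ Z → All (λ z → U zero · z ≡ true × InColSpace S z) Z → ∀ i → pushed Z i zero ≡ true
  pushed-first Z Z-props i = proj₁ (All.lookup Z-props (∈-lookup i))

  pushed-col : ∀ Z → All (λ z → U zero · z ≡ true × InColSpace S z) Z → ∀ i → InColSpace (D₁ᴹ A) (D₁ (pushed Z i))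
  pushed-col Z Z-props i =
    let (w , z≐Sw) = proj₂ (All.lookup Z-props (∈-lookup i))
    in D₁-col pq (col-≐ {M = A} (λ x → dot-congʳ (U x) z≐Sw) (US-col w))

mainTheorem3 : (m : ℕ) (A : Mat₂ (suc m)) (k : ℕ) →
    PseudoQuadratic A → HasRank A k →
    ∃ λ (k₀ : ℕ) → Odd k₀ × (2 * k₀ < 3 * k + 2) ×
      Σ (Fin k₀ → Vec₂ (suc m)) λ v →
        (∀ i → v i zero ≡ true)
        × (∀ a b → A a b ≡ sum₂ k₀ (λ i → v i a ∧ v i b))
        × (∀ i → InColSpace (D₁ᴹ A) (D₁ (v i)))
mainTheorem3 m A k pq rank =
  let (Z , odd , bound , S≋Z , Z-props) = odd-square-decomposition
  in length Z , odd , bound , pushed Z , pushed-first Z Z-props , pushed-squares Z S≋Z , pushed-col Z Z-props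
  where
  G : GramFactorisation A k
  G = gram-factorisation A (proj₁ pq) rank
  open GramFactorisation G
  open PseudoQuadraticGram pq G
  open OddDecomposition S μ S-sym gram-diag gram-unit
  open PushForward pq G
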